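{- Let $G$ split as a nontrivial amalgamated free product $G=G_1*_AG_2$. Then the action of $G$ on the associated Bass–Serre tree is dihedral if and only if $A$ has index $2$ in both $G_1$ and $G_2$.
   Context: Nontrivial means $A\neq G_1$, $A\neq G_2$. With hyperbolic length $\ell(g)=\inf_x d(x,gx)$, an action is abelian if $\ell(gh)\le\ell(g)+\ell(h)$ for all $g,h$, and dihedral if it is not abelian but this inequality holds whenever $g,h$ are hyperbolic (neither fixing a vertex nor reversing an edge). -}

module Defs where

open import Level using (Level; _⊔_; suc)
open import Algebra.Bundles using (Group)
open import Data.Bool using (Bool; true; false; not)
open import Data.List using (List; []; _∷_; foldr)
open import Data.Nat using (ℕ; zero; _+_) renaming (suc to 1+)
open import Data.Product using (Σ; ∃; _×_; _,_)
open import Data.Sum using (_⊎_)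
open import Relation.Nullary using (¬_)
open import Relation.Binary.PropositionalEquality using (_≡_)

record IsSubgroup {c ℓ p} (G : Group c ℓ) (P : Group.Carrier G → Set p) : Set (c ⊔ ℓ ⊔ p) where
  open Group G
  field
    resp : ∀ {x y} → x ≈ y → P x → P y
    ε∈   : P ε
    ∙∈   : ∀ {x y} → P x → P y → P (x ∙ y)
    ⁻¹∈  : ∀ {x} → P x → P (x ⁻¹)

-- Setting: a group G with two factor subgroups H true = G₁, H false = G₂.
-- The edge group A is their intersection.
module Splitting {c ℓ p} (G : Group c ℓ) (H : Bool → Group.Carrier G → Set p) where
  open Group G

  A : Carrier → Set p
  A x = H true x × H false x

  prod : List Carrier → Carrier
  prod = foldr _∙_ ε

  data Reduced : Bool → List Carrier → Set (c ⊔ p) where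
    one  : ∀ {i x} → H i x → ¬ A x → Reduced i (x ∷ [])
    cons : ∀ {i x xs} → H i x → ¬ A x → Reduced (not i) xs → Reduced i (x ∷ xs)

  Generated : Set (c ⊔ ℓ ⊔ p)
  Generated = ∀ g → Σ (List (Σ Carrier λ x → H true x ⊎ H false x))
                      λ ws → foldr (λ w r → Data.Product.proj₁ w ∙ r) ε ws ≈ g

  -- G = G₁ *_A G₂ (internal amalgamated free product, normal form theorem):
  -- H i are subgroups, they generate G, and no reduced word is trivial.
  IsAmalgam : Set (c ⊔ ℓ ⊔ p)
  IsAmalgam = (∀ i → IsSubgroup G (H i))
            × Generated
            × (∀ i xs → Reduced i xs → ¬ (prod xs ≈ ε))

  Nontrivial : Set (c ⊔ p)
  Nontrivial = ∀ i → ¬ (∀ g → H i g → A g)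

  Index2 : Bool → Set (c ⊔ p)
  Index2 i = Σ Carrier λ t → H i t × ¬ A t × (∀ g → H i g → A g ⊎ A (t ⁻¹ ∙ g))

  -- Bass–Serre tree: vertices gG₁ and gG₂ (represented by (side, g)),
  -- edges gA joining gG₁ and gG₂.
  Vertex : Set c
  Vertex = Bool × Carrier

  _~_ : Vertex → Vertex → Set p
  (i , x) ~ (j , y) = (i ≡ j) × H i (x ⁻¹ ∙ y)

  Adj : Vertex → Vertex → Set (c ⊔ p)
  Adj (i , x) (j , y) = ¬ (i ≡ j) × Σ Carrier λ g → H i (x ⁻¹ ∙ g) × H j (y ⁻¹ ∙ g)

  _·_ : Carrier → Vertex → Vertex
  g · (i , x) = (i , g ∙ x)

  -- Walk n v w : there is an edge path of length ≤ n from v to w,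
  -- i.e. d(v , w) ≤ n in the tree.
  data Walk : ℕ → Vertex → Vertex → Set (c ⊔ p) where
    stay : ∀ {n v w} → v ~ w → Walk n v w
    step : ∀ {n v u w} → Adj v u → Walk n u w → Walk (1+ n) v w

  -- ℓ(g) ≤ n, where ℓ(g) = inf_v d(v , g v) (attained, ℕ-valued).
  LenLE : Carrier → ℕ → Set (c ⊔ p)
  LenLE g n = Σ Vertex λ v → Walk n v (g · v)

  SubAdd : Carrier → Carrier → Set (c ⊔ p)
  SubAdd g h = ∀ m n → LenLE g m → LenLE h n → LenLE (g ∙ h) (m + n)

  Hyperbolic : Carrier → Set (c ⊔ p)
  Hyperbolic g = ¬ (Σ Vertex λ v → v ~ (g · v))
               × ¬ (Σ Vertex λ v → Σ Vertex λ w → Adj v w × (g · v) ~ w × (g · w) ~ v)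

  Abelian : Set (c ⊔ p)
  Abelian = ∀ g h → SubAdd g h

  Dihedral : Set (c ⊔ p)
  Dihedral = ¬ Abelian × (∀ g h → Hyperbolic g → Hyperbolic h → SubAdd g h)

module Submission where

-- Every element of G₁ *_A G₂ has a normal form, a reduced word alternating between G₁ ∖ A and
-- G₂ ∖ A, whose length is unique. Conjugation never shortens a cyclically reduced word w (one of
-- even length), while a walk of length m from v to w v yields a normal form of v⁻¹ w v of length
-- at most m (by parity); so the translation length of w equals its length and w is hyperbolic.
-- If A has index 2 in both factors, two letters from the same side multiply into A, so every odd
-- word is conjugate into a factor: each element is elliptic or cyclically reduced, and for
-- hyperbolic g, h the subadditivity of normal-form length gives ℓ(gh) ≤ ℓ(g) + ℓ(h), whereas
-- letters t₁ ∈ G₁, t₂ ∈ G₂ are elliptic with t₁ t₂ hyperbolic. If instead a, b ∈ G_i ∖ A lie in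
-- different cosets of A, explicit conjugates of b d (d ∈ G_{¬i} ∖ A) violate subadditivity.

open import Defs
open import Level using (_⊔_; Lift; lift; lower)
open import Algebra.Bundles using (Group)
open import Axiom.ExcludedMiddle using (ExcludedMiddle)
open import Data.Bool using (Bool; true; false; not; _≟_)
open import Data.Bool.Properties using (not-involutive; not-¬; ¬-not)
open import Data.Empty using (⊥-elim)
open import Data.List using (List; []; _∷_; _++_; _∷ʳ_; length; foldr)
open import Data.List.Properties using (length-++; length-++-≤ˡ; length-++-≤ʳ)
open import Data.Nat using (ℕ; zero; suc; _+_; _≤_; z≤n; s≤s)
import Data.Nat.Properties as ℕ
open import Data.Product using (Σ; ∃; _×_; _,_; proj₁; proj₂)
open import Data.Sum using (_⊎_; inj₁; inj₂; [_,_]′)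
open import Function.Base using (_∘_)
open import Function.Bundles using (_⇔_; mk⇔)
open import Relation.Nullary using (¬_; Dec; yes; no)
open import Relation.Nullary.Decidable using (map′; decidable-stable)
open import Relation.Binary.PropositionalEquality as ≡ using (_≡_; refl; cong; subst)

module SubgroupProperties {c ℓ p} {G : Group c ℓ} {P : Group.Carrier G → Set p}
                          (P-sub : IsSubgroup G P) where
  open Group G
  open IsSubgroup P-sub public
  open import Algebra.Properties.Group G using (⁻¹-involutive; \\-leftDividesʳ; //-rightDividesʳ)

  ∉-⁻¹ : ∀ {x} → ¬ P x → ¬ P (x ⁻¹)
  ∉-⁻¹ x∉P x⁻¹∈P = x∉P (resp (⁻¹-involutive _) (⁻¹∈ x⁻¹∈P))

  ∉-∙ˡ : ∀ {a x} → P a → ¬ P x → ¬ P (a ∙ x)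
  ∉-∙ˡ {a} {x} a∈P x∉P ax∈P = x∉P (resp (\\-leftDividesʳ a x) (∙∈ (⁻¹∈ a∈P) ax∈P))

  ∉-∙ʳ : ∀ {a x} → P a → ¬ P x → ¬ P (x ∙ a)
  ∉-∙ʳ {a} {x} a∈P x∉P xa∈P = x∉P (resp (//-rightDividesʳ a x) (∙∈ xa∈P (⁻¹∈ a∈P)))

∩-isSubgroup : ∀ {c ℓ p q} {G : Group c ℓ}
               {P : Group.Carrier G → Set p} {Q : Group.Carrier G → Set q} →
               IsSubgroup G P → IsSubgroup G Q → IsSubgroup G (λ x → P x × Q x)
∩-isSubgroup P-sub Q-sub = record
  { resp = λ x≈y (x∈P , x∈Q) → P.resp x≈y x∈P , Q.resp x≈y x∈Q
  ; ε∈   = P.ε∈ , Q.ε∈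
  ; ∙∈   = λ (x∈P , x∈Q) (y∈P , y∈Q) → P.∙∈ x∈P y∈P , Q.∙∈ x∈Q y∈Q
  ; ⁻¹∈  = λ (x∈P , x∈Q) → P.⁻¹∈ x∈P , Q.⁻¹∈ x∈Q
  }
  where
  module P = IsSubgroup P-sub
  module Q = IsSubgroup Q-sub

module Amalgam {c ℓ p} (em : ExcludedMiddle (c ⊔ ℓ ⊔ p))
               (G : Group c ℓ) (H : Bool → Group.Carrier G → Set p)
               (amalgam : Splitting.IsAmalgam G H) where

  open Group G renaming (refl to ≈-refl; sym to ≈-sym; trans to ≈-trans)
  open Splitting G H
  open import Algebra.Properties.Group G
  open import Relation.Binary.Reasoning.Setoid setoid
  open import Algebra.Solver.Monoid monoid using (solve; _⊜_; _⊕_; id)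

  private variable
    i j e e′ s : Bool
    a b g h x y z : Carrier
    xs ys ws : List Carrier
    k m n : ℕ
    u v w : Vertex

  decide : (P : Set p) → Dec P
  decide P = map′ lower lift (em {Lift (c ⊔ ℓ) P})

  decide′ : (P : Set (c ⊔ p)) → Dec P
  decide′ P = map′ lower lift (em {Lift ℓ P})

  module Factor {i : Bool} = SubgroupProperties (proj₁ amalgam i)
  module Edge = SubgroupProperties (∩-isSubgroup (proj₁ amalgam true) (proj₁ amalgam false))

  edge⊆factor : A x → H i x
  edge⊆factor {i = true}  = proj₁
  edge⊆factor {i = false} = proj₂

  Letter : Bool → Carrier → Set p
  Letter i x = H i x × ¬ A x

  letter-cast : Letter i x → Letter (not (not i)) x
  letter-cast {i} {x} = subst (λ k → Letter k x) (≡.sym (not-involutive i))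

  letter-⁻¹ : Letter i x → Letter i (x ⁻¹)
  letter-⁻¹ (x∈H , x∉A) = Factor.⁻¹∈ x∈H , Edge.∉-⁻¹ x∉A

  A∙letter : A a → Letter i x → Letter i (a ∙ x)
  A∙letter a∈A (x∈H , x∉A) = Factor.∙∈ (edge⊆factor a∈A) x∈H , Edge.∉-∙ˡ a∈A x∉A

  letter∙A : Letter i x → A a → Letter i (x ∙ a)
  letter∙A (x∈H , x∉A) a∈A = Factor.∙∈ x∈H (edge⊆factor a∈A) , Edge.∉-∙ʳ a∈A x∉A

  data ReducedWord : Bool → Bool → List Carrier → Set (c ⊔ p) where
    one  : Letter i x → ReducedWord i i (x ∷ [])
    cons : Letter i x → ReducedWord (not i) e xs → ReducedWord i e (x ∷ xs)

  startsAt : i ≡ j → ReducedWord i e xs → ReducedWord j e xs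
  startsAt refl r = r

  endsAt : e ≡ e′ → ReducedWord i e xs → ReducedWord i e′ xs
  endsAt refl r = r

  toReduced : ReducedWord i e xs → Reduced i xs
  toReduced (one (x∈H , x∉A))    = one x∈H x∉A
  toReduced (cons (x∈H , x∉A) r) = cons x∈H x∉A (toReduced r)

  prod≉ε : ReducedWord i e xs → ¬ prod xs ≈ ε
  prod≉ε r = proj₂ (proj₂ amalgam) _ _ (toReduced r)

  head-letter : ReducedWord i e (x ∷ xs) → Letter i x
  head-letter (one l)    = l
  head-letter (cons l _) = l

  replace-head : ReducedWord i e (x ∷ xs) → Letter i y → ReducedWord i e (y ∷ xs)
  replace-head (one _)    l = one l
  replace-head (cons _ r) l = cons l r

  A∙word : A a → ReducedWord i e (x ∷ xs) → ReducedWord i e (a ∙ x ∷ xs)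
  A∙word a∈A r = replace-head r (A∙letter a∈A (head-letter r))

  ++-reduced : ReducedWord i e xs → ReducedWord (not e) e′ ys → ReducedWord i e′ (xs ++ ys)
  ++-reduced (one l)    r′ = cons l r′
  ++-reduced (cons l r) r′ = cons l (++-reduced r r′)

  prod-++ : ∀ xs ys → prod (xs ++ ys) ≈ prod xs ∙ prod ys
  prod-++ []       ys = ≈-sym (identityˡ _)
  prod-++ (x ∷ xs) ys = ≈-trans (∙-congˡ (prod-++ xs ys)) (≈-sym (assoc _ _ _))

  inverseWord : List Carrier → List Carrier
  inverseWord []       = []
  inverseWord (x ∷ xs) = inverseWord xs ++ x ⁻¹ ∷ []

  prod-inverseWord : ∀ xs → prod (inverseWord xs) ≈ prod xs ⁻¹
  prod-inverseWord []       = ≈-sym ε⁻¹≈ε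
  prod-inverseWord (x ∷ xs) = begin
    prod (inverseWord xs ++ x ⁻¹ ∷ [])  ≈⟨ prod-++ (inverseWord xs) _ ⟩
    prod (inverseWord xs) ∙ (x ⁻¹ ∙ ε)  ≈⟨ ∙-cong (prod-inverseWord xs) (identityʳ _) ⟩
    prod xs ⁻¹ ∙ x ⁻¹                   ≈⟨ ⁻¹-anti-homo-∙ x (prod xs) ⟨
    (x ∙ prod xs) ⁻¹                    ∎

  length-inverseWord : ∀ xs → length (inverseWord xs) ≡ length xs
  length-inverseWord []       = refl
  length-inverseWord (x ∷ xs) = ≡.trans (length-++ (inverseWord xs))
    (≡.trans (ℕ.+-comm (length (inverseWord xs)) 1) (cong suc (length-inverseWord xs)))

  inverseWord-reduced : ReducedWord i e xs → ReducedWord e i (inverseWord xs)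
  inverseWord-reduced (one l)        = one (letter-⁻¹ l)
  inverseWord-reduced {i} (cons l r) =
    ++-reduced (inverseWord-reduced r) (startsAt (≡.sym (not-involutive i)) (one (letter-⁻¹ l)))

  Spelled : Bool → Bool → ℕ → Carrier → Set (c ⊔ ℓ ⊔ p)
  Spelled i e n z = Σ (List Carrier) λ ws → ReducedWord i e ws × length ws ≡ n × prod ws ≈ z

  spelling : ReducedWord i e xs → Spelled i e (length xs) (prod xs)
  spelling r = _ , r , refl , ≈-refl

  A∙prod : A a → ReducedWord i e xs → Spelled i e (length xs) (a ∙ prod xs)
  A∙prod {a = a} {xs = x ∷ xs} a∈A r = a ∙ x ∷ xs , A∙word a∈A r , refl , assoc _ _ _

  prod∙A : ReducedWord i e xs → A b → Spelled i e (length xs) (prod xs ∙ b)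
  prod∙A {b = b} (one {x = x} l) b∈A =
    x ∙ b ∷ [] , one (letter∙A l b∈A) , refl , ≈-trans (identityʳ _) (∙-congʳ (≈-sym (identityʳ x)))
  prod∙A (cons {x = x} l r) b∈A with prod∙A r b∈A
  ... | xs′ , r′ , len , eq =
    x ∷ xs′ , cons l r′ , cong suc len , ≈-trans (∙-congˡ eq) (≈-sym (assoc _ _ _))

  -- Normal forms

  prod-∉A : ReducedWord i e xs → ¬ A (prod xs)
  prod-∉A {xs = x ∷ xs} r w∈A = prod≉ε (A∙word (Edge.⁻¹∈ w∈A) r) (≈-trans (assoc _ _ _) (inverseˡ _))

  inverseWord-++-reduced⇒≉ : ReducedWord i e (inverseWord ys ++ xs) → ¬ prod xs ≈ prod ys
  inverseWord-++-reduced⇒≉ {ys = ys} {xs = xs} r eq = prod≉ε r (begin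
    prod (inverseWord ys ++ xs)       ≈⟨ prod-++ (inverseWord ys) xs ⟩
    prod (inverseWord ys) ∙ prod xs  ≈⟨ ∙-cong (prod-inverseWord ys) eq ⟩
    prod ys ⁻¹ ∙ prod ys             ≈⟨ inverseˡ _ ⟩
    ε                                ∎)

  strip-heads : ∀ a x xs y ys → a ∙ prod (x ∷ xs) ≈ prod (y ∷ ys) → (y ⁻¹ ∙ (a ∙ x)) ∙ prod xs ≈ prod ys
  strip-heads a x xs y ys eq = begin
    (y ⁻¹ ∙ (a ∙ x)) ∙ prod xs  ≈⟨ solve 4 (λ Y′ A′ X W → (Y′ ⊕ (A′ ⊕ X)) ⊕ W ⊜ Y′ ⊕ (A′ ⊕ (X ⊕ W)))
                                      ≈-refl (y ⁻¹) a x (prod xs) ⟩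
    y ⁻¹ ∙ (a ∙ prod (x ∷ xs))  ≈⟨ ∙-congˡ eq ⟩
    y ⁻¹ ∙ (y ∙ prod ys)        ≈⟨ \\-leftDividesʳ y (prod ys) ⟩
    prod ys                     ∎

  -- If y⁻¹ a x were not in A, then (y ∷ ys)⁻¹ (a x ∷ xs), reduced after merging the two
  -- middle letters when they lie on the same side, would be a reduced word with trivial product.
  cancel-heads : ReducedWord i e (x ∷ xs) → ReducedWord j e′ (y ∷ ys) → A a →
                 a ∙ prod (x ∷ xs) ≈ prod (y ∷ ys) → Σ Carrier λ u → A u × u ∙ prod xs ≈ prod ys
  cancel-heads {i} {e} {x} {xs} {j} {e′} {y} {ys} {a} rx ry a∈A eq with i ≟ j
  ... | no i≢j = ⊥-elim (inverseWord-++-reduced⇒≉ {ys = y ∷ ys}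
                   (++-reduced (inverseWord-reduced ry) (startsAt (¬-not i≢j) (A∙word a∈A rx)))
                   (≈-trans (assoc _ _ _) eq))
  ... | yes refl with decide (A (y ⁻¹ ∙ (a ∙ x)))
  ...   | yes u∈A = _ , u∈A , strip-heads a x xs y ys eq
  ...   | no u∉A = ⊥-elim (inverseWord-++-reduced⇒≉ {ys = ys} (merged ry) (strip-heads a x xs y ys eq))
    where
    u-letter : Letter i (y ⁻¹ ∙ (a ∙ x))
    u-letter = Factor.∙∈ (Factor.⁻¹∈ (proj₁ (head-letter ry)))
                         (Factor.∙∈ (edge⊆factor a∈A) (proj₁ (head-letter rx))) , u∉A
    merged : ReducedWord i e′ (y ∷ ys) → ReducedWord e′ e (inverseWord ys ++ y ⁻¹ ∙ (a ∙ x) ∷ xs)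
    merged (one _)    = replace-head rx u-letter
    merged (cons _ r) = ++-reduced (inverseWord-reduced r)
                                   (startsAt (≡.sym (not-involutive i)) (replace-head rx u-letter))

  length-unique : ReducedWord i e xs → ReducedWord j e′ ys → A a → a ∙ prod xs ≈ prod ys →
                  length xs ≡ length ys
  length-unique (one _) (one _) _ _ = refl
  length-unique rx@(one _) ry@(cons _ r) a∈A eq with cancel-heads rx ry a∈A eq
  ... | u , u∈A , eq′ = ⊥-elim (prod-∉A r (Edge.resp (≈-trans (≈-sym (identityʳ u)) eq′) u∈A))
  length-unique rx@(cons _ r) ry@(one _) a∈A eq with cancel-heads rx ry a∈A eq
  ... | u , u∈A , eq′ =
    ⊥-elim (prod-∉A r (Edge.resp (≈-sym (y≈x\\z _ _ _ eq′)) (Edge.∙∈ (Edge.⁻¹∈ u∈A) Edge.ε∈)))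
  length-unique rx@(cons _ r) ry@(cons _ r′) a∈A eq with cancel-heads rx ry a∈A eq
  ... | u , u∈A , eq′ = cong suc (length-unique r r′ u∈A eq′)

  data NormalForm (z : Carrier) : ℕ → Set (c ⊔ ℓ ⊔ p) where
    edge : A z → NormalForm z 0
    word : ReducedWord i e xs → prod xs ≈ z → NormalForm z (length xs)

  NormalForm-resp : x ≈ y → NormalForm x n → NormalForm y n
  NormalForm-resp x≈y (edge x∈A)  = edge (Edge.resp x≈y x∈A)
  NormalForm-resp x≈y (word r eq) = word r (≈-trans eq x≈y)

  spelled⇒normalForm : Spelled i e n z → NormalForm z n
  spelled⇒normalForm (_ , r , refl , eq) = word r eq

  normalForm-unique : NormalForm z m → NormalForm z n → m ≡ n
  normalForm-unique (edge _)     (edge _)       = refl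
  normalForm-unique (edge z∈A)   (word r eq)    = ⊥-elim (prod-∉A r (Edge.resp (≈-sym eq) z∈A))
  normalForm-unique (word r eq)  (edge z∈A)     = ⊥-elim (prod-∉A r (Edge.resp (≈-sym eq) z∈A))
  normalForm-unique (word r eq)  (word r′ eq′)  =
    length-unique r r′ Edge.ε∈ (≈-trans (identityˡ _) (≈-trans eq (≈-sym eq′)))

  NormalForm≤ : Carrier → ℕ → Set (c ⊔ ℓ ⊔ p)
  NormalForm≤ z n = Σ ℕ λ k → k ≤ n × NormalForm z k

  NormalForm≤-resp : x ≈ y → NormalForm≤ x n → NormalForm≤ y n
  NormalForm≤-resp x≈y (k , k≤n , nf) = k , k≤n , NormalForm-resp x≈y nf

  NormalForm≤-weaken : m ≤ n → NormalForm≤ z m → NormalForm≤ z n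
  NormalForm≤-weaken m≤n (k , k≤m , nf) = k , ℕ.≤-trans k≤m m≤n , nf

  factor-normalForm≤ : H i z → NormalForm≤ z 1
  factor-normalForm≤ {z = z} z∈H with decide (A z)
  ... | yes z∈A = 0 , z≤n , edge z∈A
  ... | no z∉A  = 1 , ℕ.≤-refl , word (one (z∈H , z∉A)) (identityʳ z)

  A∙normalForm : A a → NormalForm y n → NormalForm (a ∙ y) n
  A∙normalForm a∈A (edge y∈A)  = edge (Edge.∙∈ a∈A y∈A)
  A∙normalForm a∈A (word r eq) = NormalForm-resp (∙-congˡ eq) (spelled⇒normalForm (A∙prod a∈A r))

  tail-normalForm : ReducedWord i e (x ∷ xs) → NormalForm (prod xs) (length xs)
  tail-normalForm (one _)    = edge Edge.ε∈
  tail-normalForm (cons _ r) = word r ≈-refl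

  factor∙normalForm : H j h → NormalForm y n → NormalForm≤ (h ∙ y) (suc n)
  factor∙normalForm h∈H (edge y∈A) = factor-normalForm≤ (Factor.∙∈ h∈H (edge⊆factor y∈A))
  factor∙normalForm {j} {h} h∈H (word {i} {xs = x ∷ xs} r eq)
    with decide (A h) | j ≟ i | decide (A (h ∙ x))
  ... | yes h∈A | _        | _ = _ , ℕ.n≤1+n _ , A∙normalForm h∈A (word r eq)
  ... | no h∉A  | no j≢i   | _ =
    _ , ℕ.≤-refl , word (cons (h∈H , h∉A) (startsAt (¬-not (j≢i ∘ ≡.sym)) r)) (∙-congˡ eq)
  ... | no _    | yes refl | no hx∉A =
    _ , ℕ.n≤1+n _ , word (replace-head r (Factor.∙∈ h∈H (proj₁ (head-letter r)) , hx∉A))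
                         (≈-trans (assoc _ _ _) (∙-congˡ eq))
  ... | no _    | yes refl | yes hx∈A =
    _ , ℕ.m≤n+m _ 2 , NormalForm-resp (≈-trans (assoc _ _ _) (∙-congˡ eq))
                                      (A∙normalForm hx∈A (tail-normalForm r))

  word∙normalForm : ReducedWord i e xs → NormalForm y n → NormalForm≤ (prod xs ∙ y) (length xs + n)
  word∙normalForm (one {x = x} l) nf =
    NormalForm≤-resp (∙-congʳ (≈-sym (identityʳ x))) (factor∙normalForm (proj₁ l) nf)
  word∙normalForm (cons l r) nf with word∙normalForm r nf
  ... | k , k≤ , nf′ =
    NormalForm≤-weaken (s≤s k≤)
      (NormalForm≤-resp (≈-sym (assoc _ _ _)) (factor∙normalForm (proj₁ l) nf′))

  normalForm-∙ : NormalForm x m → NormalForm y n → NormalForm≤ (x ∙ y) (m + n)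
  normalForm-∙ (edge x∈A) nf  = _ , ℕ.≤-refl , A∙normalForm x∈A nf
  normalForm-∙ (word r eq) nf = NormalForm≤-resp (∙-congʳ eq) (word∙normalForm r nf)

  normalForm : ∀ g → ∃ (NormalForm g)
  normalForm g with proj₁ (proj₂ amalgam) g
  ... | gs , eq = _ , NormalForm-resp eq (proj₂ (of-generators gs))
    where
    side : H true x ⊎ H false x → ∃ λ i → H i x
    side = [ (true ,_) , (false ,_) ]′
    of-generators : ∀ gs → ∃ (NormalForm (foldr (λ w r → proj₁ w ∙ r) ε gs))
    of-generators []               = 0 , edge Edge.ε∈
    of-generators ((x , x∈H) ∷ gs) with factor∙normalForm (proj₂ (side x∈H)) (proj₂ (of-generators gs))
    ... | k , _ , nf = k , nf

  Spelled-resp : y ≈ z → Spelled i e n y → Spelled i e n z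
  Spelled-resp y≈z (ws , r , len , eq) = ws , r , len , ≈-trans eq y≈z

  A∙spelled : A a → Spelled i e n z → Spelled i e n (a ∙ z)
  A∙spelled a∈A (_ , r , refl , eq) = Spelled-resp (∙-congˡ eq) (A∙prod a∈A r)

  length-∷ʳ : ∀ (xs : List Carrier) x → length (xs ∷ʳ x) ≡ suc (length xs)
  length-∷ʳ xs x = ≡.trans (length-++ xs) (ℕ.+-comm (length xs) 1)

  spelled-∷ʳ : Spelled i e n z → ReducedWord (not e) e′ (x ∷ []) → Spelled i e′ (suc n) (z ∙ x)
  spelled-∷ʳ {x = x} (ws , r , refl , eq) r′ =
    ws ∷ʳ x , ++-reduced r r′ , length-∷ʳ ws x , ≈-trans (prod-++ ws _) (∙-cong eq (identityʳ x))

  spelled-⁻¹ : Spelled i e n z → Spelled e i n (z ⁻¹)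
  spelled-⁻¹ (ws , r , len , eq) =
    inverseWord ws , inverseWord-reduced r , ≡.trans (length-inverseWord ws) len ,
    ≈-trans (prod-inverseWord ws) (⁻¹-cong eq)

  CyclicallyReduced : Bool → List Carrier → Set (c ⊔ p)
  CyclicallyReduced i = ReducedWord i (not i)

  CyclicSpelled : ℕ → Carrier → Set (c ⊔ ℓ ⊔ p)
  CyclicSpelled n z = Σ Bool λ i → Spelled i (not i) n z

  cyclic-uncons : CyclicallyReduced i (z ∷ ws) → Letter i z × ReducedWord (not i) (not i) ws
  cyclic-uncons {true}  (cons lz r) = lz , r
  cyclic-uncons {false} (cons lz r) = lz , r

  infix 7.5 _^_
  _^_ : Carrier → Carrier → Carrier
  w ^ x = x ⁻¹ ∙ (w ∙ x)

  ^-cong : ∀ {w w′} → w ≈ w′ → x ≈ y → w ^ x ≈ w′ ^ y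
  ^-cong w≈w′ x≈y = ∙-cong (⁻¹-cong x≈y) (∙-cong w≈w′ x≈y)

  ^-∙ : ∀ w x y → w ^ (x ∙ y) ≈ (w ^ x) ^ y
  ^-∙ w x y = begin
    (x ∙ y) ⁻¹ ∙ (w ∙ (x ∙ y))    ≈⟨ ∙-congʳ (⁻¹-anti-homo-∙ x y) ⟩
    (y ⁻¹ ∙ x ⁻¹) ∙ (w ∙ (x ∙ y))  ≈⟨ solve 5 (λ Y′ X′ W X Y →
                                          (Y′ ⊕ X′) ⊕ (W ⊕ (X ⊕ Y)) ⊜ Y′ ⊕ ((X′ ⊕ (W ⊕ X)) ⊕ Y))
                                        ≈-refl (y ⁻¹) (x ⁻¹) w x y ⟩
    y ⁻¹ ∙ ((x ⁻¹ ∙ (w ∙ x)) ∙ y)  ∎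

  ^-⁻¹ : ∀ w x → (w ^ x) ⁻¹ ≈ w ⁻¹ ^ x
  ^-⁻¹ w x = begin
    (x ⁻¹ ∙ (w ∙ x)) ⁻¹        ≈⟨ ⁻¹-anti-homo-∙ (x ⁻¹) (w ∙ x) ⟩
    (w ∙ x) ⁻¹ ∙ x ⁻¹ ⁻¹       ≈⟨ ∙-cong (⁻¹-anti-homo-∙ w x) (⁻¹-involutive x) ⟩
    (x ⁻¹ ∙ w ⁻¹) ∙ x          ≈⟨ assoc _ _ _ ⟩
    x ⁻¹ ∙ (w ⁻¹ ∙ x)          ∎

  prod-^ : ∀ xs ys → prod (inverseWord ys ++ xs ++ ys) ≈ prod xs ^ prod ys
  prod-^ xs ys = begin
    prod (inverseWord ys ++ xs ++ ys)     ≈⟨ prod-++ (inverseWord ys) _ ⟩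
    prod (inverseWord ys) ∙ prod (xs ++ ys) ≈⟨ ∙-cong (prod-inverseWord ys) (prod-++ xs ys) ⟩
    prod ys ⁻¹ ∙ (prod xs ∙ prod ys)      ∎

  ConjugateByLetter : Bool → Carrier → List Carrier → Set (c ⊔ ℓ ⊔ p)
  ConjugateByLetter s x ws = Spelled s s (suc (length ws)) (prod ws ^ x)
                           ⊎ CyclicSpelled (length ws) (prod ws ^ x)

  ^-via-head : ∀ x z w → ((x ⁻¹ ∙ z) ∙ w) ∙ x ≈ (z ∙ w) ^ x
  ^-via-head x z w =
    solve 4 (λ X′ Z W X → ((X′ ⊕ Z) ⊕ W) ⊕ X ⊜ X′ ⊕ ((Z ⊕ W) ⊕ X)) ≈-refl (x ⁻¹) z w x

  -- The first letter z of the cyclic word merges with x⁻¹; x is appended as a new last letter.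
  ^-letter-front : Letter i x → CyclicallyReduced i ws → ConjugateByLetter i x ws
  ^-letter-front {i} {x} {z ∷ ws} lx r with cyclic-uncons r | decide (A (x ⁻¹ ∙ z))
  ... | lz , r′ | no u∉A = inj₁ (Spelled-resp (^-via-head x z (prod ws))
          (spelled-∷ʳ (spelling (cons (Factor.∙∈ (Factor.⁻¹∈ (proj₁ lx)) (proj₁ lz) , u∉A) r′))
                      (endsAt (not-involutive i) (one (letter-cast lx)))))
  ... | lz , r′ | yes u∈A = inj₂ (not i , Spelled-resp (^-via-head x z (prod ws))
          (spelled-∷ʳ (A∙prod u∈A r′) (one (letter-cast lx))))

  spelled-^-inverseWord : m ≡ n → Spelled i e m (prod (inverseWord ws) ^ x) →
                          Spelled e i n (prod ws ^ x)
  spelled-^-inverseWord {ws = ws} {x = x} m≡n sp with spelled-⁻¹ sp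
  ... | vs , r , len , eq = vs , r , ≡.trans len m≡n , ≈-trans eq (begin
    (prod (inverseWord ws) ^ x) ⁻¹  ≈⟨ ^-⁻¹ _ x ⟩
    prod (inverseWord ws) ⁻¹ ^ x    ≈⟨ ^-cong (⁻¹-cong (prod-inverseWord ws)) ≈-refl ⟩
    prod ws ⁻¹ ⁻¹ ^ x               ≈⟨ ^-cong (⁻¹-involutive _) ≈-refl ⟩
    prod ws ^ x                     ∎)

  -- A letter from the other side is handled by inverting: ws⁻¹ is cyclically reduced from side s.
  ^-letter : Letter s x → CyclicallyReduced i ws → ConjugateByLetter s x ws
  ^-letter {s} {x} {i} {ws} lx r with s ≟ i
  ... | yes refl = ^-letter-front lx r
  ... | no s≢i with ¬-not s≢i
  ...   | refl with ^-letter-front lx (endsAt (≡.sym (not-involutive i)) (inverseWord-reduced r))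
  ...     | inj₁ sp       = inj₁ (spelled-^-inverseWord {ws = ws} (cong suc (length-inverseWord ws)) sp)
  ...     | inj₂ (σ , sp) =
    inj₂ (not σ , subst (λ e → Spelled (not σ) e _ _) (≡.sym (not-involutive σ))
                        (spelled-^-inverseWord {ws = ws} (length-inverseWord ws) sp))

  NormalForm≥ : Carrier → ℕ → Set (c ⊔ ℓ ⊔ p)
  NormalForm≥ z n = Σ ℕ λ k → n ≤ k × NormalForm z k

  NormalForm≥-resp : x ≈ y → NormalForm≥ x n → NormalForm≥ y n
  NormalForm≥-resp x≈y (k , n≤k , nf) = k , n≤k , NormalForm-resp x≈y nf

  NormalForm≥-weaken : m ≤ n → NormalForm≥ z n → NormalForm≥ z m
  NormalForm≥-weaken m≤n (k , n≤k , nf) = k , ℕ.≤-trans m≤n n≤k , nf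

  conjugateByLetter≥ : ConjugateByLetter s x ws → NormalForm≥ (prod ws ^ x) (length ws)
  conjugateByLetter≥ (inj₁ sp)       = _ , ℕ.n≤1+n _ , spelled⇒normalForm sp
  conjugateByLetter≥ (inj₂ (_ , sp)) = _ , ℕ.≤-refl , spelled⇒normalForm sp

  -- Conjugating by the letters of xs one at a time keeps the word cyclically reduced of the same
  -- length until the first step without cancellation; after that step no letter of xs cancels.
  ^-word≥ : ReducedWord s e xs → CyclicallyReduced i ws → NormalForm≥ (prod ws ^ prod xs) (length ws)
  ^-word≥ {ws = ws} (one {x = x} lx) r =
    NormalForm≥-resp (^-cong ≈-refl (≈-sym (identityʳ x)))
                     (conjugateByLetter≥ {ws = ws} (^-letter lx r))
  ^-word≥ {s} {ws = ws} (cons {x = x} {xs = xs} lx rxs) r with ^-letter lx r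
  ... | inj₂ (_ , vs , r′ , len , eq) =
    NormalForm≥-weaken (ℕ.≤-reflexive (≡.sym len))
      (NormalForm≥-resp (≈-trans (^-cong eq ≈-refl) (≈-sym (^-∙ _ x _))) (^-word≥ rxs r′))
  ... | inj₁ (vs , r′ , len , eq) =
    _ , ws≤ , word (++-reduced (inverseWord-reduced rxs)
                               (startsAt (≡.sym (not-involutive s)) (++-reduced r′ rxs)))
                   (≈-trans (prod-^ vs xs) (≈-trans (^-cong eq ≈-refl) (≈-sym (^-∙ _ x _))))
    where
    ws≤ : length ws ≤ length (inverseWord xs ++ vs ++ xs)
    ws≤ = ℕ.≤-trans (ℕ.n≤1+n _) (ℕ.≤-trans (ℕ.≤-reflexive (≡.sym len))
            (ℕ.≤-trans (length-++-≤ˡ vs) (length-++-≤ʳ (vs ++ xs) {inverseWord xs})))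

  ^-normalForm≥ : NormalForm x m → CyclicallyReduced i ws → NormalForm≥ (prod ws ^ x) (length ws)
  ^-normalForm≥ (edge x∈A) r =
    _ , ℕ.≤-refl , spelled⇒normalForm (A∙spelled (Edge.⁻¹∈ x∈A) (prod∙A r x∈A))
  ^-normalForm≥ (word rxs eq) r = NormalForm≥-resp (^-cong ≈-refl eq) (^-word≥ rxs r)

  -- The Bass–Serre tree

  Elliptic : Carrier → Set (c ⊔ p)
  Elliptic g = Σ Vertex λ v → v ~ (g · v)

  ~-refl : v ~ v
  ~-refl {i , x} = refl , Factor.resp (≈-sym (inverseˡ x)) Factor.ε∈

  ~-reflexive : i ≡ j → x ≈ y → (i , x) ~ (j , y)
  ~-reflexive {x = x} refl x≈y =
    refl , Factor.resp (≈-trans (≈-sym (inverseˡ x)) (∙-congˡ x≈y)) Factor.ε∈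

  ~-trans : u ~ v → v ~ w → u ~ w
  ~-trans {i , x} {_ , y} {_ , z} (refl , x⁻¹y∈H) (refl , y⁻¹z∈H) =
    refl , Factor.resp (≈-trans (assoc _ _ _) (∙-congˡ (\\-leftDividesˡ y z))) (Factor.∙∈ x⁻¹y∈H y⁻¹z∈H)

  ⁻¹∙-translate : ∀ g x y → (g ∙ x) ⁻¹ ∙ (g ∙ y) ≈ x ⁻¹ ∙ y
  ⁻¹∙-translate g x y = begin
    (g ∙ x) ⁻¹ ∙ (g ∙ y)     ≈⟨ ∙-congʳ (⁻¹-anti-homo-∙ g x) ⟩
    (x ⁻¹ ∙ g ⁻¹) ∙ (g ∙ y)  ≈⟨ assoc _ _ _ ⟩
    x ⁻¹ ∙ (g ⁻¹ ∙ (g ∙ y))  ≈⟨ ∙-congˡ (\\-leftDividesʳ g y) ⟩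
    x ⁻¹ ∙ y                 ∎

  ·-resp-~ : v ~ w → (g · v) ~ (g · w)
  ·-resp-~ {i , x} {_ , y} {g} (refl , x⁻¹y∈H) = refl , Factor.resp (≈-sym (⁻¹∙-translate g x y)) x⁻¹y∈H

  ·-resp-Adj : Adj v w → Adj (g · v) (g · w)
  ·-resp-Adj {i , x} {j , y} {g} (i≢j , k , x⁻¹k∈H , y⁻¹k∈H) =
    i≢j , g ∙ k , Factor.resp (≈-sym (⁻¹∙-translate g x k)) x⁻¹k∈H
                , Factor.resp (≈-sym (⁻¹∙-translate g y k)) y⁻¹k∈H

  Walk-· : Walk n v w → Walk n (g · v) (g · w)
  Walk-· (stay v~w)   = stay (·-resp-~ v~w)
  Walk-· (step adj w) = step (·-resp-Adj adj) (Walk-· w)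

  Walk-end : Walk n v w → w ~ u → Walk n v u
  Walk-end (stay v~w)   w~u = stay (~-trans v~w w~u)
  Walk-end (step adj w) w~u = step adj (Walk-end w w~u)

  Walk-weaken : m ≤ n → Walk m v w → Walk n v w
  Walk-weaken _         (stay v~w)   = stay v~w
  Walk-weaken (s≤s m≤n) (step adj w) = step adj (Walk-weaken m≤n w)

  -- z = h₀ h₁ ⋯ hⱼ with j ≤ k, each hₜ in the factor on the side reached after t steps from i.
  data AlternatingProduct : Bool → ℕ → Carrier → Set (c ⊔ ℓ ⊔ p) where
    factor : H i z → AlternatingProduct i k z
    extend : H i h → AlternatingProduct (not i) k y → h ∙ y ≈ z → AlternatingProduct i (suc k) z

  factor∙alternating : H i h → AlternatingProduct i k y → AlternatingProduct i k (h ∙ y)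
  factor∙alternating h∈H (factor y∈H)        = factor (Factor.∙∈ h∈H y∈H)
  factor∙alternating h∈H (extend h′∈H ap eq) =
    extend (Factor.∙∈ h∈H h′∈H) ap (≈-trans (assoc _ _ _) (∙-congˡ eq))

  alternating⇒normalForm≤ : AlternatingProduct i k z → NormalForm≤ z (suc k)
  alternating⇒normalForm≤ (factor z∈H)        = NormalForm≤-weaken (s≤s z≤n) (factor-normalForm≤ z∈H)
  alternating⇒normalForm≤ (extend h∈H ap eq) with alternating⇒normalForm≤ ap
  ... | k , k≤ , nf = NormalForm≤-resp eq (NormalForm≤-weaken (s≤s k≤) (factor∙normalForm h∈H nf))

  flips : ℕ → Bool → Bool
  flips zero    i = i
  flips (suc k) i = flips k (not i)

  flips-not : ∀ k i → flips k (not i) ≡ not (flips k i)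
  flips-not zero    i = refl
  flips-not (suc k) i = flips-not k (not i)

  flips-parity : flips k i ≡ i → flips k j ≡ j
  flips-parity {k} {i} {j} fk with i ≟ j
  ... | yes refl = fk
  ... | no i≢j with ¬-not (i≢j ∘ ≡.sym)
  ...   | refl = ≡.trans (flips-not k i) (cong not fk)

  same-parity-≤ : flips m i ≡ i → flips n j ≡ j → m ≤ suc n → m ≤ n
  same-parity-≤ {m} {i} {n} fm fn m≤1+n with ℕ.m≤n⇒m<n∨m≡n m≤1+n
  ... | inj₁ m<1+n = ℕ.≤-pred m<1+n
  ... | inj₂ refl  = ⊥-elim (not-¬ refl (≡.sym not-i≡i))
    where
    not-i≡i : not i ≡ i
    not-i≡i = ≡.trans (cong not (≡.sym (flips-parity {n} fn))) (≡.trans (≡.sym (flips-not n i)) fm)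

  word-parity : ReducedWord i e xs → not e ≡ flips (length xs) i
  word-parity (one _)    = refl
  word-parity (cons _ r) = word-parity r

  cyclic-parity : CyclicallyReduced i ws → flips (length ws) i ≡ i
  cyclic-parity {i} r = ≡.trans (≡.sym (word-parity r)) (not-involutive i)

  walk⇒alternating : Walk n (i , x) (j , y) →
                     Σ ℕ λ k → k ≤ n × AlternatingProduct i k (x ⁻¹ ∙ y) × j ≡ flips k i
  walk⇒alternating (stay (refl , x⁻¹y∈H)) = 0 , z≤n , factor x⁻¹y∈H , refl
  walk⇒alternating {x = x} {y = y} (step {u = _ , u} (i≢i′ , g , x⁻¹g∈H , u⁻¹g∈H) w)
    with walk⇒alternating w | ¬-not (i≢i′ ∘ ≡.sym)
  ... | k , k≤n , ap , j≡ | refl =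
    suc k , s≤s k≤n ,
    extend x⁻¹g∈H (factor∙alternating (Factor.⁻¹∈ u⁻¹g∈H) ap)
           (≈-trans (∙-congˡ (⁻¹∙-translate (u ⁻¹) g y))
                    (≈-trans (assoc _ _ _) (∙-congˡ (\\-leftDividesˡ g y)))) ,
    j≡

  edge-from-ε : H s x → Adj (s , ε) (not s , x ∙ ε)
  edge-from-ε {x = x} x∈H =
    not-¬ refl , x , Factor.resp (≈-sym (≈-trans (∙-congʳ ε⁻¹≈ε) (identityˡ x))) x∈H
                   , Factor.resp (≈-sym (≈-trans (∙-congʳ (⁻¹-cong (identityʳ x))) (inverseˡ x))) Factor.ε∈

  word-walk : ReducedWord s e ws → Walk (length ws) (s , ε) (not e , prod ws)
  word-walk (one (x∈H , _))            = step (edge-from-ε x∈H) (stay ~-refl)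
  word-walk (cons {x = x} (x∈H , _) r) = step (edge-from-ε x∈H) (Walk-· {g = x} (word-walk r))

  LenLE-resp : g ≈ h → LenLE g n → LenLE h n
  LenLE-resp g≈h (v , w) = v , Walk-end w (~-reflexive refl (∙-congʳ g≈h))

  LenLE-weaken : m ≤ n → LenLE g m → LenLE g n
  LenLE-weaken m≤n (v , w) = v , Walk-weaken m≤n w

  LenLE-^ : LenLE g n → LenLE (g ^ y) n
  LenLE-^ {g} {y = y} ((i , x) , w) =
    (i , y ⁻¹ ∙ x) , Walk-end (Walk-· {g = y ⁻¹} w) (~-reflexive refl (begin
      y ⁻¹ ∙ (g ∙ x)                 ≈⟨ ∙-congˡ (∙-congˡ (\\-leftDividesˡ y x)) ⟨
      y ⁻¹ ∙ (g ∙ (y ∙ (y ⁻¹ ∙ x)))  ≈⟨ solve 5 (λ Y′ G Y Y″ X →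
                                            Y′ ⊕ (G ⊕ (Y ⊕ (Y″ ⊕ X))) ⊜ (Y′ ⊕ (G ⊕ Y)) ⊕ (Y″ ⊕ X))
                                          ≈-refl (y ⁻¹) g y (y ⁻¹) x ⟩
      (g ^ y) ∙ (y ⁻¹ ∙ x)           ∎))

  cyclic-length≤ : CyclicallyReduced i ws → LenLE (prod ws) (length ws)
  cyclic-length≤ {i} r =
    (i , ε) , Walk-end (word-walk r) (~-reflexive (not-involutive i) (≈-sym (identityʳ _)))

  Elliptic-resp : g ≈ h → Elliptic g → Elliptic h
  Elliptic-resp g≈h (v , fix) = v , ~-trans fix (~-reflexive refl (∙-congʳ g≈h))

  factor-elliptic : H i g → Elliptic g
  factor-elliptic {i} {g} g∈H =
    (i , ε) , refl , Factor.resp (≈-sym (≈-trans (∙-congʳ ε⁻¹≈ε) (≈-trans (identityˡ _) (identityʳ g)))) g∈H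

  elliptic-length : Elliptic g → LenLE g 0
  elliptic-length (v , fix) = v , stay fix

  elliptic-^ : Elliptic (g ^ y) → Elliptic g
  elliptic-^ {g} {y} ((i , x) , fix) =
    y · (i , x) , ~-trans (·-resp-~ {g = y} fix) (~-reflexive refl (begin
      y ∙ ((y ⁻¹ ∙ (g ∙ y)) ∙ x)  ≈⟨ solve 5 (λ Y Y′ G Y″ X →
                                         Y ⊕ ((Y′ ⊕ (G ⊕ Y″)) ⊕ X) ⊜ Y ⊕ (Y′ ⊕ ((G ⊕ Y″) ⊕ X)))
                                       ≈-refl y (y ⁻¹) g y x ⟩
      y ∙ (y ⁻¹ ∙ ((g ∙ y) ∙ x))  ≈⟨ \\-leftDividesˡ y _ ⟩
      (g ∙ y) ∙ x                  ≈⟨ assoc _ _ _ ⟩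
      g ∙ (y ∙ x)                  ∎))

  ¬elliptic⇒hyperbolic : ¬ Elliptic g → Hyperbolic g
  ¬elliptic⇒hyperbolic ¬elliptic = ¬elliptic , λ (_ , _ , (i≢j , _) , (i≡j , _) , _) → i≢j i≡j

  hyperbolic-^ : Hyperbolic g → Hyperbolic (g ^ y)
  hyperbolic-^ (¬elliptic , _) = ¬elliptic⇒hyperbolic (¬elliptic ∘ elliptic-^)

  -- A walk of length m from (j , x) to g · (j , x) gives a normal form of x⁻¹ g x of length ≤ m + 1,
  -- hence ≤ m by parity, while conjugates of a cyclically reduced word are never shorter than it.
  cyclic-length≥ : CyclicallyReduced i ws → g ≈ prod ws → LenLE g m → length ws ≤ m
  cyclic-length≥ r g≈W ((j , x) , w) with walk⇒alternating w
  ... | k , k≤m , ap , j≡ with alternating⇒normalForm≤ ap | ^-normalForm≥ (proj₂ (normalForm x)) r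
  ...   | n , n≤1+k , nf | n′ , ws≤n′ , nf′
          with normalForm-unique nf (NormalForm-resp (^-cong (≈-sym g≈W) ≈-refl) nf′)
  ...     | refl = ℕ.≤-trans (same-parity-≤ (cyclic-parity r) (≡.sym j≡) (ℕ.≤-trans ws≤n′ n≤1+k)) k≤m

  cyclic-hyperbolic : CyclicallyReduced i ws → g ≈ prod ws → Hyperbolic g
  cyclic-hyperbolic {ws = _ ∷ _} r g≈W =
    ¬elliptic⇒hyperbolic λ (v , fix) → ℕ.n≮0 (cyclic-length≥ r g≈W (v , stay fix))

  -- Index two implies dihedral

  data Last (i e : Bool) : List Carrier → Set (c ⊔ p) where
    only : Letter e x → i ≡ e → Last i e (x ∷ [])
    snoc : ReducedWord i (not e) ws → Letter e x → Last i e (ws ∷ʳ x)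

  last : ReducedWord i e ws → Last i e ws
  last (one lx) = only lx refl
  last {i} (cons lx r) with last r
  ... | only ly refl = snoc (endsAt (≡.sym (not-involutive i)) (one lx)) ly
  ... | snoc r′ ly   = snoc (cons lx r′) ly

  index2-merge : Index2 i → Letter i x → Letter i y → A (x ∙ y)
  index2-merge {x = x} {y = y} (t , _ , _ , cosets) (x∈H , x∉A) (y∈H , y∉A)
    with cosets x x∈H | cosets (x ∙ y) (Factor.∙∈ x∈H y∈H)
  ... | inj₁ x∈A    | _            = ⊥-elim (x∉A x∈A)
  ... | inj₂ _      | inj₁ xy∈A    = xy∈A
  ... | inj₂ t⁻¹x∈A | inj₂ t⁻¹xy∈A = ⊥-elim (y∉A (Edge.resp (\\-leftDividesʳ (t ⁻¹ ∙ x) y)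
          (Edge.∙∈ (Edge.⁻¹∈ t⁻¹x∈A) (Edge.resp (≈-sym (assoc _ _ _)) t⁻¹xy∈A))))

  module _ (index2 : ∀ i → Index2 i) where

    -- Conjugating x ws l by its first letter x gives ws (l x) with l x ∈ A, a shorter odd word.
    odd-elliptic : ∀ n → ReducedWord s s ws → length ws ≤ n → Elliptic (prod ws)
    odd-elliptic _ (one (x∈H , _)) _ = factor-elliptic (Factor.∙∈ x∈H Factor.ε∈)
    odd-elliptic (suc n) (cons {x = x} lx r) (s≤s len≤n) with last r
    ... | only _ ¬s≡s = ⊥-elim (not-¬ refl (≡.sym ¬s≡s))
    ... | snoc {ws = ws} {x = l} rw ll with prod∙A rw (index2-merge (index2 _) ll lx)
    ...   | vs , rv , len , eq = elliptic-^ {y = x} (Elliptic-resp rotate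
              (odd-elliptic n rv (ℕ.≤-trans (ℕ.≤-reflexive len) (ℕ.≤-trans (length-++-≤ˡ ws) len≤n))))
      where
      rotate : prod vs ≈ prod (x ∷ ws ∷ʳ l) ^ x
      rotate = begin
        prod vs                             ≈⟨ eq ⟩
        prod ws ∙ (l ∙ x)                   ≈⟨ solve 3 (λ W L X → W ⊕ (L ⊕ X) ⊜ (W ⊕ (L ⊕ id)) ⊕ X)
                                                        ≈-refl (prod ws) l x ⟩
        (prod ws ∙ (l ∙ ε)) ∙ x             ≈⟨ ∙-congʳ (prod-++ ws (l ∷ [])) ⟨
        prod (ws ∷ʳ l) ∙ x                  ≈⟨ \\-leftDividesʳ x _ ⟨
        x ⁻¹ ∙ (x ∙ (prod (ws ∷ʳ l) ∙ x))  ≈⟨ ∙-congˡ (assoc _ _ _) ⟨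
        prod (x ∷ ws ∷ʳ l) ^ x              ∎

    classify : NormalForm z n → Elliptic z ⊎ CyclicSpelled n z
    classify (edge z∈A) = inj₁ (factor-elliptic (edge⊆factor {i = true} z∈A))
    classify (word {i} {e} r eq) with e ≟ i
    ... | yes refl = inj₁ (Elliptic-resp eq (odd-elliptic _ r ℕ.≤-refl))
    ... | no e≢i with ¬-not e≢i
    ...   | refl = inj₂ (i , _ , r , refl , eq)

    hyperbolic⇒cyclic : Hyperbolic g → LenLE g m → Σ ℕ λ n → n ≤ m × CyclicSpelled n g
    hyperbolic⇒cyclic {g} (¬elliptic , _) ℓg with normalForm g
    ... | _ , nf with classify nf
    ...   | inj₁ elliptic                 = ⊥-elim (¬elliptic elliptic)
    ...   | inj₂ (i , ws , r , refl , eq) = _ , cyclic-length≥ r (≈-sym eq) ℓg , i , ws , r , refl , eq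

    -- Normal-form length is subadditive, and for hyperbolic elements it equals translation length.
    hyperbolic-subadditive : Hyperbolic g → Hyperbolic h → SubAdd g h
    hyperbolic-subadditive hg hh m n ℓg ℓh with hyperbolic⇒cyclic hg ℓg | hyperbolic⇒cyclic hh ℓh
    ... | _ , Lg≤m , _ , sg | _ , Lh≤n , _ , sh
          with normalForm-∙ (spelled⇒normalForm sg) (spelled⇒normalForm sh)
    ...   | k , k≤ , nf with classify nf
    ...     | inj₁ (v , fix) = v , stay fix
    ...     | inj₂ (_ , _ , r , refl , eq) =
      LenLE-weaken (ℕ.≤-trans k≤ (ℕ.+-mono-≤ Lg≤m Lh≤n)) (LenLE-resp eq (cyclic-length≤ r))

  one₂ : Letter i x → Letter (not i) y → CyclicallyReduced i (x ∷ y ∷ [])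
  one₂ lx ly = cons lx (one ly)

  cons₂ : Letter i x → Letter (not i) y → ReducedWord i e ws → ReducedWord i e (x ∷ y ∷ ws)
  cons₂ {i} lx ly r = cons lx (cons ly (startsAt (≡.sym (not-involutive i)) r))

  letters⇒¬abelian : Letter true x → Letter false y → ¬ Abelian
  letters⇒¬abelian {x} {y} lx ly abelian =
    ℕ.n≮0 (cyclic-length≥ (one₂ lx ly) (∙-congˡ (≈-sym (identityʳ y)))
                          (abelian x y 0 0 (elliptic-length (factor-elliptic (proj₁ lx)))
                                           (elliptic-length (factor-elliptic (proj₁ ly)))))

  index2⇒dihedral : Index2 true → Index2 false → Dihedral
  index2⇒dihedral idx₁@(_ , t∈H₁ , t∉A₁ , _) idx₂@(_ , t∈H₂ , t∉A₂ , _) =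
    letters⇒¬abelian (t∈H₁ , t∉A₁) (t∈H₂ , t∉A₂) , λ _ _ → hyperbolic-subadditive index2
    where
    index2 : ∀ i → Index2 i
    index2 true  = idx₁
    index2 false = idx₂

  -- Dihedral implies index two

  letter-exists : Nontrivial → ∀ i → ∃ (Letter i)
  letter-exists nontrivial i with decide′ (∃ (Letter i))
  ... | yes l  = l
  ... | no ¬l  =
    ⊥-elim (nontrivial i λ g g∈H → decidable-stable (decide (A g)) λ g∉A → ¬l (g , g∈H , g∉A))

  ¬index2⇒other-coset : Letter i a → ¬ Index2 i → ∃ λ b → Letter i b × ¬ A (a ⁻¹ ∙ b)
  ¬index2⇒other-coset {i} {a} (a∈H , a∉A) ¬index2 with decide′ (∃ λ b → Letter i b × ¬ A (a ⁻¹ ∙ b))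
  ... | yes b = b
  ... | no ¬b = ⊥-elim (¬index2 (a , a∈H , a∉A , cosets))
    where
    cosets : ∀ g → H i g → A g ⊎ A (a ⁻¹ ∙ g)
    cosets g g∈H with decide (A g)
    ... | yes g∈A = inj₁ g∈A
    ... | no g∉A  = inj₂ (decidable-stable (decide _) λ a⁻¹g∉A → ¬b (g , (g∈H , g∉A) , a⁻¹g∉A))

  -- g₁ = (b d)^a and g₂ = (b d)^(a d⁻¹) have translation length 2, while
  -- g₁ g₂ = (a⁻¹b) d a d (a⁻¹b) d a d⁻¹ is cyclically reduced of length 8.
  other-coset⇒¬subadditive : ∀ {a b d} → Letter i a → Letter i b → ¬ A (a ⁻¹ ∙ b) → Letter (not i) d →
                             ¬ (∀ g h → Hyperbolic g → Hyperbolic h → SubAdd g h)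
  other-coset⇒¬subadditive {i} {a} {b} {d} la@(a∈H , _) lb@(b∈H , _) a⁻¹b∉A ld subadditive =
    8≰4 (cyclic-length≥ gh-word gh≈
           (subadditive g₁ g₂ (hyperbolic-^ bd-hyperbolic) (hyperbolic-^ bd-hyperbolic) 2 2
                        (LenLE-^ (cyclic-length≤ bd-word)) (LenLE-^ (cyclic-length≤ bd-word))))
    where
    bd-word : CyclicallyReduced i (b ∷ d ∷ [])
    bd-word = one₂ lb ld
    bd-hyperbolic : Hyperbolic (prod (b ∷ d ∷ []))
    bd-hyperbolic = cyclic-hyperbolic bd-word ≈-refl
    g₁ g₂ : Carrier
    g₁ = prod (b ∷ d ∷ []) ^ a
    g₂ = prod (b ∷ d ∷ []) ^ (a ∙ d ⁻¹)
    la⁻¹b : Letter i (a ⁻¹ ∙ b)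
    la⁻¹b = Factor.∙∈ (Factor.⁻¹∈ a∈H) b∈H , a⁻¹b∉A
    gh-word : CyclicallyReduced i (a ⁻¹ ∙ b ∷ d ∷ a ∷ d ∷ a ⁻¹ ∙ b ∷ d ∷ a ∷ d ⁻¹ ∷ [])
    gh-word = cons₂ la⁻¹b ld (cons₂ la ld (cons₂ la⁻¹b ld (one₂ la (letter-⁻¹ ld))))
    gh≈ : g₁ ∙ g₂ ≈ prod (a ⁻¹ ∙ b ∷ d ∷ a ∷ d ∷ a ⁻¹ ∙ b ∷ d ∷ a ∷ d ⁻¹ ∷ [])
    gh≈ = ≈-trans (∙-congˡ (∙-congʳ (≈-trans (⁻¹-anti-homo-∙ a (d ⁻¹)) (∙-congʳ (⁻¹-involutive d)))))
      (solve 5 (λ A′ B D A D′ →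
         (A′ ⊕ ((B ⊕ (D ⊕ id)) ⊕ A)) ⊕ ((D ⊕ A′) ⊕ ((B ⊕ (D ⊕ id)) ⊕ (A ⊕ D′)))
         ⊜ (A′ ⊕ B) ⊕ (D ⊕ (A ⊕ (D ⊕ ((A′ ⊕ B) ⊕ (D ⊕ (A ⊕ (D′ ⊕ id))))))))
         ≈-refl (a ⁻¹) b d a (d ⁻¹))
    8≰4 : ¬ 8 ≤ 4
    8≰4 (s≤s (s≤s (s≤s (s≤s ()))))

  dihedral⇒index2 : Nontrivial → Dihedral → ∀ i → Index2 i
  dihedral⇒index2 nontrivial (_ , subadditive) i with decide′ (Index2 i)
  ... | yes index2 = index2
  ... | no ¬index2 with letter-exists nontrivial i | letter-exists nontrivial (not i)
  ...   | a , la | d , ld with ¬index2⇒other-coset la ¬index2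
  ...     | b , lb , a⁻¹b∉A = ⊥-elim (other-coset⇒¬subadditive la lb a⁻¹b∉A ld subadditive)

  dihedral⇔index2 : Nontrivial → Dihedral ⇔ (Index2 true × Index2 false)
  dihedral⇔index2 nontrivial = mk⇔
    (λ dihedral → dihedral⇒index2 nontrivial dihedral true , dihedral⇒index2 nontrivial dihedral false)
    (λ (idx₁ , idx₂) → index2⇒dihedral idx₁ idx₂)

lemma3p5 : ∀ {c ℓ p} → ExcludedMiddle (c ⊔ ℓ ⊔ p) →
    (G : Group c ℓ) (H : Bool → Group.Carrier G → Set p) →
    Splitting.IsAmalgam G H → Splitting.Nontrivial G H →
    Splitting.Dihedral G H ⇔ (Splitting.Index2 G H true × Splitting.Index2 G H false)
lemma3p5 em G H amalgam = Amalgam.dihedral⇔index2 em G H amalgam
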